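{- For an arbitrary paging request sequence $r$ and arbitrary positive integers $k,h$ with $\ell_k(r)\ge1$, \[\frac{\mathrm{cost}_{\mathrm{OPT}}(h,r)}{\ell_k(r)}\ge \frac{k-h+m_k(r)}{2}.\]
   Context: Paging problem: there are $h$ identical servers, initially on no node. Requests arrive, each to a node. If the requested node has no server, either a server that has never been used is placed on it at no cost, or some server is moved to it from its current node at cost $1$. $\mathrm{cost}_{\mathrm{OPT}}(h,r)$ is the minimum total cost of serving request sequence $r$ with $h$ servers. For a positive integer $k$, the $k$-phases of $r$: the first $k$-phase is the longest prefix of $r$ containing requests to at most $k$ distinct nodes; the $i$-th $k$-phase is the longest block of consecutive requests beginning with the request following the $(i-1)$-st $k$-phase and containing requests to at most $k$ distinct nodes. $\ell_k(r)$ is the number of $k$-phases minus $1$. In a $k$-phase other than the first, a new request is a request to a node not requested previously in that $k$-phase nor in the previous $k$-phase. $m_k(r)$ is the total number of new requests divided by $\ell_k(r)$. -}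

module Defs where

open import Data.Nat using (ℕ; zero; suc; _+_; _∸_; _<ᵇ_; _≡ᵇ_)
open import Data.Bool using (Bool; true; false; if_then_else_; _∨_)
open import Data.List using (List; []; _∷_; _++_; [_]; length)
open import Data.Bool.ListAction using (any)
open import Data.Fin using (Fin; _≟_)
open import Data.Maybe using (Maybe; just; nothing)
open import Data.Product using (∃)
open import Relation.Binary.PropositionalEquality using (_≡_; _≢_)
open import Relation.Nullary.Decidable using (⌊_⌋)

Node : Set
Node = ℕ

-- Configuration of h servers: each server is either unused (nothing)
-- or located at some node (just v).
Config : ℕ → Set
Config h = Fin h → Maybe Node

initial : ∀ {h} → Config h
initial _ = nothing

upd : ∀ {h} → Config h → Fin h → Maybe Node → Config h
upd conf i x j = if ⌊ i ≟ j ⌋ then x else conf j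

data Serves (h : ℕ) : Config h → List Node → ℕ → Set where
  done  : ∀ {conf} → Serves h conf [] 0
  hit   : ∀ {conf v rs c} → (∃ λ i → conf i ≡ just v) →
          Serves h conf rs c → Serves h conf (v ∷ rs) c
  place : ∀ {conf v rs c} (i : Fin h) → (∀ j → conf j ≢ just v) →
          conf i ≡ nothing →
          Serves h (upd conf i (just v)) rs c → Serves h conf (v ∷ rs) c
  move  : ∀ {conf v rs c} (i : Fin h) (u : Node) → (∀ j → conf j ≢ just v) →
          conf i ≡ just u →
          Serves h (upd conf i (just v)) rs c → Serves h conf (v ∷ rs) (suc c)

_∈ᵇ_ : Node → List Node → Bool
v ∈ᵇ xs = any (v ≡ᵇ_) xs

-- Greedy decomposition into k-phases.
-- phasesGo k D B rs : D = distinct nodes of the current phase, B = current phase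
phasesGo : ℕ → List Node → List Node → List Node → List (List Node)
phasesGo k D B [] = B ∷ []
phasesGo k D B (v ∷ rs) =
  if v ∈ᵇ D then phasesGo k D (B ++ [ v ]) rs
  else (if length D <ᵇ k then phasesGo k (v ∷ D) (B ++ [ v ]) rs
        else B ∷ phasesGo k (v ∷ []) (v ∷ []) rs)

phases : ℕ → List Node → List (List Node)
phases k r = phasesGo k [] [] r

ell : ℕ → List Node → ℕ
ell k r = length (phases k r) ∸ 1

-- number of new requests in phase `cur` whose previous phase is `prev`;
-- `seen` = nodes requested previously in the current phase
newIn : List Node → List Node → List Node → ℕ
newIn prev seen [] = 0
newIn prev seen (v ∷ vs) =
  (if (v ∈ᵇ prev) ∨ (v ∈ᵇ seen) then 0 else 1) + newIn prev (v ∷ seen) vs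

newTotalPh : List (List Node) → ℕ
newTotalPh (p ∷ q ∷ rest) = newIn p [] q + newTotalPh (q ∷ rest)
newTotalPh _ = 0

newTotal : ℕ → List Node → ℕ
newTotal k r = newTotalPh (phases k r)

-- Count, for a set S of nodes, the distinct nodes outside S that a request
-- sequence visits. Every such node needs a server that was free at the start
-- (unused, or sitting outside S) or a paid move, so the count is at most
-- cost + h. Take two consecutive k-phases p and q: the at least k distinct
-- nodes of p plus the new requests of q are distinct nodes of p ++ q, so they
-- are bounded by the cost spent on p and q plus h. Summing over the ℓ windows
-- charges the cost of every phase at most twice.
module Submission where

open import Defs
open import Data.Nat using (ℕ; _+_; _*_; _≤_)
open import Data.List using (List)

open import Algebra.Bundles using (CommutativeMonoid)
open import Data.Bool using (Bool; true; false; not; _∨_; T; if_then_else_)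
open import Data.Bool.Properties using (∨-assoc; ∨-comm; ∨-commutativeMonoid; T-≡)
open import Data.Empty using (⊥-elim)
open import Data.Fin using (Fin; _≟_)
open import Data.Fin.Subset using (Subset; _∈_; _∉_; _⊆_; _⊂_; ∣_∣)
open import Data.Fin.Subset.Properties using (p⊆q⇒∣p∣≤∣q∣; p⊂q⇒∣p∣<∣q∣; ∣p∣≤n)
open import Data.List using ([]; _∷_; _++_; [_]; length; concat)
open import Data.List.Properties using (++-assoc; ++-identityʳ)
open import Data.Maybe using (Maybe; just; nothing)
open import Data.Nat using (suc; _∸_; _<ᵇ_; _≡ᵇ_; z≤n; s≤s)
open import Data.Nat.Properties
  using ( +-assoc; +-comm; +-identityʳ; +-mono-≤; +-monoˡ-≤; +-monoʳ-≤; +-monoʳ-<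
        ; +-cancelʳ-≤; *-zeroʳ; m≤m+n; ≤-trans; ≮⇒≥; <⇒<ᵇ; ≡ᵇ⇒≡; ≡⇒≡ᵇ; module ≤-Reasoning)
open import Data.Nat.Tactic.RingSolver using (solve-∀)
open import Data.Product using (_,_; _×_; proj₂)
open import Data.Vec using (tabulate)
open import Data.Vec.Properties using (lookup∘tabulate; lookup⇒[]=; []=⇒lookup)
open import Function using (Equivalence)
open import Relation.Nullary using (yes; no)
open import Relation.Binary.PropositionalEquality
  using (_≡_; _≢_; refl; sym; trans; cong; cong₂; subst; module ≡-Reasoning)

open import Algebra.Properties.CommutativeSemigroup
  (CommutativeMonoid.commutativeSemigroup ∨-commutativeMonoid) using (x∙yz≈y∙xz)

≡ᵇ-refl : ∀ v → (v ≡ᵇ v) ≡ true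
≡ᵇ-refl v = Equivalence.to T-≡ (≡⇒≡ᵇ v v refl)

SameElements : List Node → List Node → Set
SameElements S S′ = ∀ w → w ∈ᵇ S ≡ w ∈ᵇ S′

∈ᵇ-++ : ∀ w A B → w ∈ᵇ (A ++ B) ≡ (w ∈ᵇ A) ∨ (w ∈ᵇ B)
∈ᵇ-++ w []      B = refl
∈ᵇ-++ w (a ∷ A) B =
  trans (cong ((w ≡ᵇ a) ∨_) (∈ᵇ-++ w A B)) (sym (∨-assoc (w ≡ᵇ a) (w ∈ᵇ A) (w ∈ᵇ B)))

∷-sameElements : ∀ {S S′} v → SameElements S S′ → SameElements (v ∷ S) (v ∷ S′)
∷-sameElements v eq w = cong ((w ≡ᵇ v) ∨_) (eq w)

++-∷-sameElements : ∀ A a S → SameElements (A ++ a ∷ S) (a ∷ A ++ S)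
++-∷-sameElements A a S w = begin
  w ∈ᵇ (A ++ a ∷ S)                     ≡⟨ ∈ᵇ-++ w A (a ∷ S) ⟩
  (w ∈ᵇ A) ∨ ((w ≡ᵇ a) ∨ (w ∈ᵇ S))      ≡⟨ x∙yz≈y∙xz (w ∈ᵇ A) (w ≡ᵇ a) (w ∈ᵇ S) ⟩
  (w ≡ᵇ a) ∨ ((w ∈ᵇ A) ∨ (w ∈ᵇ S))      ≡⟨ cong ((w ≡ᵇ a) ∨_) (sym (∈ᵇ-++ w A S)) ⟩
  w ∈ᵇ (a ∷ A ++ S)                     ∎
  where open ≡-Reasoning

snoc-sameElements : ∀ B v → SameElements (B ++ [ v ]) (v ∷ B)
snoc-sameElements B v w = subst (λ B′ → w ∈ᵇ (B ++ [ v ]) ≡ w ∈ᵇ (v ∷ B′))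
                                (++-identityʳ B) (++-∷-sameElements B v [] w)

∷-absorb : ∀ {v S} → v ∈ᵇ S ≡ true → SameElements (v ∷ S) S
∷-absorb {v} v∈S w with w ≡ᵇ v in w≡ᵇv
... | true  rewrite ≡ᵇ⇒≡ w v (Equivalence.from T-≡ w≡ᵇv) = sym v∈S
... | false = refl

distinctOutside : List Node → List Node → ℕ
distinctOutside S []       = 0
distinctOutside S (v ∷ vs) = (if v ∈ᵇ S then 0 else 1) + distinctOutside (v ∷ S) vs

distinctOutside-cong : ∀ {S S′} → SameElements S S′ → ∀ xs →
  distinctOutside S xs ≡ distinctOutside S′ xs
distinctOutside-cong         eq []       = refl
distinctOutside-cong {S} {S′} eq (v ∷ vs) =
  cong₂ _+_ (cong (if_then 0 else 1) (eq v)) (distinctOutside-cong (∷-sameElements {S} {S′} v eq) vs)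

distinctOutside-++ : ∀ S A B →
  distinctOutside S (A ++ B) ≡ distinctOutside S A + distinctOutside (A ++ S) B
distinctOutside-++ S []      B = refl
distinctOutside-++ S (a ∷ A) B = begin
  first + distinctOutside (a ∷ S) (A ++ B)
    ≡⟨ cong (first +_) (distinctOutside-++ (a ∷ S) A B) ⟩
  first + (distinctOutside (a ∷ S) A + distinctOutside (A ++ a ∷ S) B)
    ≡⟨ sym (+-assoc first _ _) ⟩
  first + distinctOutside (a ∷ S) A + distinctOutside (A ++ a ∷ S) B
    ≡⟨ cong (first + distinctOutside (a ∷ S) A +_) (distinctOutside-cong (++-∷-sameElements A a S) B) ⟩
  first + distinctOutside (a ∷ S) A + distinctOutside (a ∷ A ++ S) B
    ∎
  where
  open ≡-Reasoning
  first = if a ∈ᵇ S then 0 else 1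

distinctOutside-snoc : ∀ B v →
  distinctOutside [] (B ++ [ v ]) ≡ distinctOutside [] B + (if v ∈ᵇ B then 0 else 1)
distinctOutside-snoc B v rewrite distinctOutside-++ [] B [ v ] | ++-identityʳ B =
  cong (distinctOutside [] B +_) (+-identityʳ _)

newIn≡distinctOutside : ∀ prev seen xs → newIn prev seen xs ≡ distinctOutside (seen ++ prev) xs
newIn≡distinctOutside prev seen []       = refl
newIn≡distinctOutside prev seen (v ∷ vs) =
  cong₂ _+_ (cong (if_then 0 else 1) (trans (∨-comm (v ∈ᵇ prev) (v ∈ᵇ seen)) (sym (∈ᵇ-++ v seen prev))))
            (newIn≡distinctOutside prev (v ∷ seen) vs)

∈-tabulate⁺ : ∀ {n} {f : Fin n → Bool} {i} → f i ≡ true → i ∈ tabulate f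
∈-tabulate⁺ {f = f} {i} fi = lookup⇒[]= i (tabulate f) (trans (lookup∘tabulate f i) fi)

∈-tabulate⁻ : ∀ {n} {f : Fin n → Bool} {i} → i ∈ tabulate f → f i ≡ true
∈-tabulate⁻ {f = f} {i} i∈f = trans (sym (lookup∘tabulate f i)) ([]=⇒lookup i∈f)

isFree : List Node → Maybe Node → Bool
isFree S nothing  = true
isFree S (just u) = not (u ∈ᵇ S)

freeServers : ∀ {h} → Config h → List Node → Subset h
freeServers conf S = tabulate (λ i → isFree S (conf i))

isFree-∷ : ∀ v S x → isFree (v ∷ S) x ≡ true → isFree S x ≡ true
isFree-∷ v S nothing  _ = refl
isFree-∷ v S (just u) free with u ≡ᵇ v
... | false = free

isFree-∷-here : ∀ v S → isFree (v ∷ S) (just v) ≡ false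
isFree-∷-here v S rewrite ≡ᵇ-refl v = refl

Relocated : ∀ {h} → Config h → Config h → Fin h → Node → Set
Relocated conf conf′ i v = conf′ i ≡ just v × (∀ j → i ≢ j → conf′ j ≡ conf j)

stay-relocated : ∀ {h} {conf : Config h} {i v} → conf i ≡ just v → Relocated conf conf i v
stay-relocated conf-i = conf-i , λ _ _ → refl

upd-relocated : ∀ {h} (conf : Config h) i v → Relocated conf (upd conf i (just v)) i v
upd-relocated conf i v = at-i , elsewhere
  where
  at-i : upd conf i (just v) i ≡ just v
  at-i with i ≟ i
  ... | yes _  = refl
  ... | no i≢i = ⊥-elim (i≢i refl)
  elsewhere : ∀ j → i ≢ j → upd conf i (just v) j ≡ conf j
  elsewhere j i≢j with i ≟ j
  ... | yes i≡j = ⊥-elim (i≢j i≡j)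
  ... | no _    = refl

relocated-∉ : ∀ {h} {conf conf′ : Config h} {i v} S → Relocated conf conf′ i v →
  i ∉ freeServers conf′ (v ∷ S)
relocated-∉ {v = v} S (at-i , _) i∈
  with () ← trans (sym (isFree-∷-here v S))
                  (subst (λ x → isFree (v ∷ S) x ≡ true) at-i (∈-tabulate⁻ i∈))

relocated-⊆ : ∀ {h} {conf conf′ : Config h} {i v} S → Relocated conf conf′ i v →
  freeServers conf′ (v ∷ S) ⊆ freeServers conf S
relocated-⊆ {conf = conf} {i = i} {v} S rel {j} j∈ with i ≟ j
... | yes refl = ⊥-elim (relocated-∉ S rel j∈)
... | no i≢j   = ∈-tabulate⁺ (isFree-∷ v S (conf j)
                   (subst (λ x → isFree (v ∷ S) x ≡ true) (proj₂ rel j i≢j) (∈-tabulate⁻ j∈)))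

relocated-⊂ : ∀ {h} {conf conf′ : Config h} {i v} S → Relocated conf conf′ i v →
  isFree S (conf i) ≡ true → freeServers conf′ (v ∷ S) ⊂ freeServers conf S
relocated-⊂ {i = i} S rel free-i = relocated-⊆ S rel , i , ∈-tabulate⁺ free-i , relocated-∉ S rel

ifThen0Else1≤1 : ∀ b → (if b then 0 else 1) ≤ 1
ifThen0Else1≤1 true  = z≤n
ifThen0Else1≤1 false = s≤s z≤n

distinctOutside≤cost+free : ∀ {h conf xs c} → Serves h conf xs c → ∀ S →
  distinctOutside S xs ≤ c + ∣ freeServers conf S ∣
distinctOutside≤cost+free done S = z≤n
distinctOutside≤cost+free {conf = conf} {v ∷ rs} {c} (hit (i , conf-i) s) S with v ∈ᵇ S in v∈S
... | true  = ≤-trans (distinctOutside≤cost+free s (v ∷ S))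
                (+-monoʳ-≤ c (p⊆q⇒∣p∣≤∣q∣ (relocated-⊆ S (stay-relocated {conf = conf} conf-i))))
... | false = ≤-trans (s≤s (distinctOutside≤cost+free s (v ∷ S)))
                (+-monoʳ-< c (p⊂q⇒∣p∣<∣q∣ (relocated-⊂ S (stay-relocated {conf = conf} conf-i) free-i)))
  where
  free-i : isFree S (conf i) ≡ true
  free-i rewrite conf-i | v∈S = refl
distinctOutside≤cost+free {conf = conf} {v ∷ rs} {c} (place i _ conf-i s) S =
  ≤-trans (+-mono-≤ (ifThen0Else1≤1 (v ∈ᵇ S)) (distinctOutside≤cost+free s (v ∷ S)))
    (+-monoʳ-< c (p⊂q⇒∣p∣<∣q∣ (relocated-⊂ S (upd-relocated conf i v) free-i)))
  where
  free-i : isFree S (conf i) ≡ true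
  free-i rewrite conf-i = refl
distinctOutside≤cost+free {conf = conf} {v ∷ rs} (move i _ _ _ s) S =
  +-mono-≤ (ifThen0Else1≤1 (v ∈ᵇ S))
    (≤-trans (distinctOutside≤cost+free s (v ∷ S))
      (+-monoʳ-≤ _ (p⊆q⇒∣p∣≤∣q∣ (relocated-⊆ S (upd-relocated conf i v)))))

window-bound : ∀ {h conf c k} p q → Serves h conf (p ++ q) c → k ≤ distinctOutside [] p →
  k + newIn p [] q ≤ c + h
window-bound {h} {conf} {c} {k} p q s k≤p = begin
  k + newIn p [] q                                    ≤⟨ +-monoˡ-≤ _ k≤p ⟩
  distinctOutside [] p + newIn p [] q                 ≡⟨ cong (distinctOutside [] p +_) (newIn≡distinctOutside p [] q) ⟩
  distinctOutside [] p + distinctOutside p q          ≡⟨ cong (λ P → distinctOutside [] p + distinctOutside P q) (sym (++-identityʳ p)) ⟩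
  distinctOutside [] p + distinctOutside (p ++ []) q  ≡⟨ sym (distinctOutside-++ [] p q) ⟩
  distinctOutside [] (p ++ q)                         ≤⟨ distinctOutside≤cost+free s [] ⟩
  c + ∣ freeServers conf [] ∣                         ≤⟨ +-monoʳ-≤ c (∣p∣≤n (freeServers conf [])) ⟩
  c + h                                               ∎
  where open ≤-Reasoning

record Split {h} (conf : Config h) (A B : List Node) (c : ℕ) : Set where
  field
    mid        : Config h
    prefixCost : ℕ
    suffixCost : ℕ
    cost-≡     : c ≡ prefixCost + suffixCost
    prefix     : Serves h conf A prefixCost
    suffix     : Serves h mid B suffixCost
    extend     : ∀ {B′ c′} → Serves h mid B′ c′ → Serves h conf (A ++ B′) (prefixCost + c′)

split : ∀ {h} A {B} {conf : Config h} {c} → Serves h conf (A ++ B) c → Split conf A B c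
split [] {conf = conf} {c} s = record
  { mid = conf ; prefixCost = 0 ; suffixCost = c ; cost-≡ = refl
  ; prefix = done ; suffix = s ; extend = λ s′ → s′ }
split (a ∷ A) (hit cover s) = let open Split (split A s) in record
  { mid = mid ; prefixCost = prefixCost ; suffixCost = suffixCost ; cost-≡ = cost-≡
  ; prefix = hit cover prefix ; suffix = suffix ; extend = λ s′ → hit cover (extend s′) }
split (a ∷ A) (place i uncovered unused s) = let open Split (split A s) in record
  { mid = mid ; prefixCost = prefixCost ; suffixCost = suffixCost ; cost-≡ = cost-≡
  ; prefix = place i uncovered unused prefix ; suffix = suffix
  ; extend = λ s′ → place i uncovered unused (extend s′) }
split (a ∷ A) (move i u uncovered at-u s) = let open Split (split A s) in record
  { mid = mid ; prefixCost = suc prefixCost ; suffixCost = suffixCost ; cost-≡ = cong suc cost-≡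
  ; prefix = move i u uncovered at-u prefix ; suffix = suffix
  ; extend = λ s′ → move i u uncovered at-u (extend s′) }

data FullPhases (k : ℕ) : List (List Node) → Set where
  lastPhase : ∀ p → FullPhases k (p ∷ [])
  fullPhase : ∀ {p ps} → k ≤ distinctOutside [] p → FullPhases k ps → FullPhases k (p ∷ ps)

concat-phasesGo : ∀ k D B rs → concat (phasesGo k D B rs) ≡ B ++ rs
concat-phasesGo k D B [] = refl
concat-phasesGo k D B (v ∷ rs) with v ∈ᵇ D | length D <ᵇ k
... | true  | _     = trans (concat-phasesGo k D (B ++ [ v ]) rs) (++-assoc B [ v ] rs)
... | false | true  = trans (concat-phasesGo k (v ∷ D) (B ++ [ v ]) rs) (++-assoc B [ v ] rs)
... | false | false = cong (B ++_) (concat-phasesGo k [ v ] [ v ] rs)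

fullPhases-phasesGo : ∀ k D B rs → SameElements B D → distinctOutside [] B ≡ length D →
  FullPhases k (phasesGo k D B rs)
fullPhases-phasesGo k D B [] _ _ = lastPhase B
fullPhases-phasesGo k D B (v ∷ rs) B∼D count with v ∈ᵇ D in v∈D
... | true = fullPhases-phasesGo k D (B ++ [ v ]) rs
    (λ w → trans (snoc-sameElements B v w) (trans (∷-sameElements {B} {D} v B∼D w) (∷-absorb {v} {D} v∈D w)))
    count′
  where
  count′ : distinctOutside [] (B ++ [ v ]) ≡ length D
  count′ rewrite distinctOutside-snoc B v | B∼D v | v∈D = trans (+-identityʳ _) count
... | false with length D <ᵇ k in D<k
...   | true = fullPhases-phasesGo k (v ∷ D) (B ++ [ v ]) rs
    (λ w → trans (snoc-sameElements B v w) (∷-sameElements {B} {D} v B∼D w))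
    count′
  where
  count′ : distinctOutside [] (B ++ [ v ]) ≡ suc (length D)
  count′ rewrite distinctOutside-snoc B v | B∼D v | v∈D = trans (+-comm _ 1) (cong suc count)
...   | false = fullPhase k≤B (fullPhases-phasesGo k [ v ] [ v ] rs (λ _ → refl) refl)
  where
  k≤B : k ≤ distinctOutside [] B
  k≤B rewrite count = ≮⇒≥ (λ D<k′ → subst T D<k (<⇒<ᵇ D<k′))

window-sum-step : ∀ k h L n N cp cq cr →
  k * L + N + cq ≤ 2 * cr + h * L → k + n ≤ cp + cq + h →
  k * suc L + (n + N) + cp ≤ 2 * (cp + cr) + h * suc L
window-sum-step k h L n N cp cq cr rest window = +-cancelʳ-≤ cq _ _ (begin
  k * suc L + (n + N) + cp + cq            ≡⟨ regroupˡ k L n N cp cq ⟩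
  (k + n) + (k * L + N + cq) + cp          ≤⟨ +-monoˡ-≤ cp (+-mono-≤ window rest) ⟩
  (cp + cq + h) + (2 * cr + h * L) + cp    ≡⟨ regroupʳ k h L cp cq cr ⟩
  2 * (cp + cr) + h * suc L + cq           ∎)
  where
  open ≤-Reasoning
  regroupˡ : ∀ k L n N cp cq →
    k * suc L + (n + N) + cp + cq ≡ (k + n) + (k * L + N + cq) + cp
  regroupˡ = solve-∀
  regroupʳ : ∀ k h L cp cq cr →
    (cp + cq + h) + (2 * cr + h * L) + cp ≡ 2 * (cp + cr) + h * suc L + cq
  regroupʳ = solve-∀

window-sum : ∀ {h k} p rest {conf : Config h} {c} → FullPhases k (p ∷ rest) →
  (s : Serves h conf (p ++ concat rest) c) →
  k * length rest + newTotalPh (p ∷ rest) + Split.prefixCost (split p s) ≤ 2 * c + h * length rest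
window-sum {h} {k} p [] {c = c} _ s = begin
  k * 0 + 0 + prefixCost  ≡⟨ cong (λ x → x + 0 + prefixCost) (*-zeroʳ k) ⟩
  prefixCost              ≤⟨ m≤m+n prefixCost suffixCost ⟩
  prefixCost + suffixCost ≡⟨ sym cost-≡ ⟩
  c                       ≤⟨ m≤m+n c (c + 0) ⟩
  2 * c                   ≤⟨ m≤m+n (2 * c) (h * 0) ⟩
  2 * c + h * 0           ∎
  where
  open ≤-Reasoning
  open Split (split p s)
window-sum {h} {k} p (q ∷ rest) (fullPhase k≤p full) s =
  subst (λ c → k * suc (length rest) + newTotalPh (p ∷ q ∷ rest) + prefixCost ≤ 2 * c + h * suc (length rest))
    (sym cost-≡)
    (window-sum-step k h (length rest) (newIn p [] q) (newTotalPh (q ∷ rest))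
      prefixCost (Split.prefixCost qSplit) suffixCost
      (window-sum q rest full suffix)
      (window-bound p q (extend (Split.prefix qSplit)) k≤p))
  where
  open Split (split p s)
  qSplit = split q suffix

phases-bound : ∀ {h k} {conf : Config h} {c} ps → FullPhases k ps → Serves h conf (concat ps) c →
  k * (length ps ∸ 1) + newTotalPh ps ≤ 2 * c + h * (length ps ∸ 1)
phases-bound (p ∷ rest) full s = ≤-trans (m≤m+n _ _) (window-sum p rest full s)

mainTheorem6 : (r : List Node) (k h : ℕ) → 1 ≤ k → 1 ≤ h → 1 ≤ ell k r →
    (c : ℕ) → Serves h initial r c →
    k * ell k r + newTotal k r ≤ 2 * c + h * ell k r
mainTheorem6 r k h _ _ _ c s =
  phases-bound (phases k r) (fullPhases-phasesGo k [] [] r (λ _ → refl) refl)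
    (subst (λ xs → Serves h initial xs c) (sym (concat-phasesGo k [] [] r)) s)
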